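{- For any reduction order $>$ and any argument filtering function $\pi$, the relation $\gtrsim_\pi$ is a weak reduction order.
   Context: Setting: HRSs à la Nipkow. Simple types are generated from a set $\mathcal B$ of basic types by $\to$. Terms are simply-typed $\lambda$-terms over typed variables $\mathcal V$ and typed function symbols $\Sigma$ in $\beta$-normal $\eta$-long form, up to $\alpha$-equivalence $\equiv$; $s{\downarrow}$ is the $\beta$-normal $\eta$-long form; every term has the form $\lambda x_1\ldots x_m.a(t_1,\ldots,t_n)$ with $a\in\Sigma\cup\mathcal V$. Substitutions map variables to terms of the same type; $t\theta{\downarrow}$ is the normal form of the substituted term. A relation is closed under substitution if $s\,R\,t$ implies $s\theta{\downarrow}\,R\,t\theta{\downarrow}$ for all $\theta$, and closed under contexts if $s\,R\,t$ implies $C[s]\,R\,C[t]$. A reduction order is a well-founded relation on terms closed under substitution and context. A pair $(\gtrsim,>)$ of relations is a reduction pair if $>$ is well-founded and closed under substitutions, $\gtrsim$ is closed under contexts and substitutions, and ${\gtrsim\cdot>}\subseteq{>}$ or ${>\cdot\gtrsim}\subseteq{>}$; $\gtrsim$ is a weak reduction order if $(\gtrsim,\ \gtrsim\setminus\lesssim)$ is a reduction pair. An argument filtering function $\pi$ assigns to every $f\in\Sigma$ of type $\alpha_1\to\cdots\to\alpha_n\to\beta$ with $\beta\in\mathcal B$ either a positive integer $i\le n$ with $\alpha_i=\beta$, or a list $[i_1,\ldots,i_k]$ of positive integers $\le n$; it is extended to terms by $\pi(\lambda\vec x.a(t_1,\ldots,t_n))\equiv\lambda\vec x.\pi(t_i)$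 if $a\in\Sigma$, $\pi(a)=i$; $\equiv\lambda\vec x.a(\pi(t_{i_1}),\ldots,\pi(t_{i_k}))$ if $a\in\Sigma$, $\pi(a)=[i_1,\ldots,i_k]$; $\equiv\lambda\vec x.a(\pi(t_1),\ldots,\pi(t_n))$ if $a\in\mathcal V$ (filtered terms are typed by $type_\pi(a)=\alpha_{i_1}\to\cdots\to\alpha_{i_k}\to\beta$ when $\pi(a)=[i_1,\ldots,i_k]$, $type_\pi(a)=type(a)$ otherwise; the reduction order $>$ is on such terms). Given $\pi$ and $>$, $s\gtrsim_\pi t$ iff $\pi(s)>\pi(t)$ or $\pi(s)\equiv\pi(t)$. -}

module Defs where

open import Data.List using (List; []; _∷_; length; lookup; map)
open import Data.Fin using (Fin; zero; suc)
open import Data.Product using (Σ; _×_; _,_)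
open import Data.Sum using (_⊎_; inj₁; inj₂)
open import Relation.Nullary using (¬_)
open import Relation.Binary.PropositionalEquality using (_≡_; refl; sym; trans; subst)
open import Induction.WellFounded using (WellFounded)

infixr 6 _⇒_

data Ty (B : Set) : Set where
  ι   : B → Ty B
  _⇒_ : Ty B → Ty B → Ty B

args : {B : Set} → Ty B → List (Ty B)
args (ι _)   = []
args (σ ⇒ τ) = σ ∷ args τ

target : {B : Set} → Ty B → B
target (ι b)   = b
target (σ ⇒ τ) = target τ

build : {B : Set} → B → List (Ty B) → Ty B
build b []       = ι b
build b (σ ∷ σs) = σ ⇒ build b σs

-- Typing contexts of (de Bruijn) variables: terms are taken up to α
-- by using de Bruijn indices.

infixl 5 _,,_

data Con (B : Set) : Set where
  ε    : Con B
  _,,_ : Con B → Ty B → Con B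

data Var {B : Set} : Con B → Ty B → Set where
  vz : ∀ {Γ σ} → Var (Γ ,, σ) σ
  vs : ∀ {Γ σ τ} → Var Γ τ → Var (Γ ,, σ) τ

record Signature (B : Set) : Set₁ where
  field
    Sym  : Set
    type : Sym → Ty B
open Signature public

-- Terms in β-normal η-long form:  λx₁…xₘ. a(t₁,…,tₙ)
-- (Sp Γ σ ρ : a spine of arguments taking a head of type σ to type ρ)

module _ {B : Set} (S : Signature B) where

  data Nf (Γ : Con B) : Ty B → Set
  data Ne (Γ : Con B) : Ty B → Set
  data Sp (Γ : Con B) : Ty B → Ty B → Set

  data Nf Γ where
    lam : ∀ {σ τ} → Nf (Γ ,, σ) τ → Nf Γ (σ ⇒ τ)
    ne  : ∀ {b} → Ne Γ (ι b) → Nf Γ (ι b)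

  data Ne Γ where
    var : ∀ {σ τ} → Var Γ σ → Sp Γ σ τ → Ne Γ τ
    fun : ∀ {τ} (f : Sym S) → Sp Γ (type S f) τ → Ne Γ τ

  data Sp Γ where
    []  : ∀ {σ} → Sp Γ σ σ
    _∷_ : ∀ {σ τ ρ} → Nf Γ σ → Sp Γ τ ρ → Sp Γ (σ ⇒ τ) ρ

-- Hereditary substitution (computes (tθ)↓ on β-normal η-long terms)

_-_ : {B : Set} {σ : Ty B} (Γ : Con B) → Var Γ σ → Con B
(Γ ,, σ) - vz   = Γ
(Γ ,, τ) - vs x = (Γ - x) ,, τ

wkv : {B : Set} {Γ : Con B} {σ τ : Ty B} (x : Var Γ σ) → Var (Γ - x) τ → Var Γ τ
wkv vz     y      = vs y
wkv (vs x) vz     = vz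
wkv (vs x) (vs y) = vs (wkv x y)

data EqV {B : Set} {Γ : Con B} : {σ τ : Ty B} → Var Γ σ → Var Γ τ → Set where
  same : ∀ {σ} {x : Var Γ σ} → EqV x x
  diff : ∀ {σ τ} (x : Var Γ σ) (y : Var (Γ - x) τ) → EqV x (wkv x y)

eqv : {B : Set} {Γ : Con B} {σ τ : Ty B} (x : Var Γ σ) (y : Var Γ τ) → EqV x y
eqv vz     vz     = same
eqv vz     (vs y) = diff vz y
eqv (vs x) vz     = diff (vs x) vz
eqv (vs x) (vs y) with eqv x y
... | same     = same
... | diff x y' = diff (vs x) (vs y')

module _ {B : Set} {S : Signature B} where

  wkNf : ∀ {Γ σ τ} (x : Var Γ σ) → Nf S (Γ - x) τ → Nf S Γ τ
  wkNe : ∀ {Γ σ τ} (x : Var Γ σ) → Ne S (Γ - x) τ → Ne S Γ τ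
  wkSp : ∀ {Γ σ τ ρ} (x : Var Γ σ) → Sp S (Γ - x) τ ρ → Sp S Γ τ ρ

  wkNf x (lam t) = lam (wkNf (vs x) t)
  wkNf x (ne n)  = ne (wkNe x n)
  wkNe x (var y ts) = var (wkv x y) (wkSp x ts)
  wkNe x (fun f ts) = fun f (wkSp x ts)
  wkSp x []       = []
  wkSp x (t ∷ ts) = wkNf x t ∷ wkSp x ts

  appSp : ∀ {Γ ρ σ τ} → Sp S Γ ρ (σ ⇒ τ) → Nf S Γ σ → Sp S Γ ρ τ
  appSp []       u = u ∷ []
  appSp (t ∷ ts) u = t ∷ appSp ts u

  nvar  : ∀ {Γ σ} → Var Γ σ → Nf S Γ σ
  ne2nf : ∀ {Γ σ ρ} → Var Γ ρ → Sp S Γ ρ σ → Nf S Γ σ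
  nvar x = ne2nf x []
  ne2nf {σ = ι b}   x ts = ne (var x ts)
  ne2nf {σ = σ ⇒ τ} x ts = lam (ne2nf (vs x) (appSp (wkSp vz ts) (nvar vz)))

  _[_:=_]  : ∀ {Γ σ τ} → Nf S Γ τ → (x : Var Γ σ) → Nf S (Γ - x) σ → Nf S (Γ - x) τ
  _⟨_:=_⟩  : ∀ {Γ σ τ ρ} → Sp S Γ τ ρ → (x : Var Γ σ) → Nf S (Γ - x) σ → Sp S (Γ - x) τ ρ
  _◇_      : ∀ {Γ σ τ} → Nf S Γ σ → Sp S Γ σ τ → Nf S Γ τ
  napp     : ∀ {Γ σ τ} → Nf S Γ (σ ⇒ τ) → Nf S Γ σ → Nf S Γ τ

  lam t [ x := u ] = lam (t [ vs x := wkNf vz u ])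
  ne (fun f ts) [ x := u ] = ne (fun f (ts ⟨ x := u ⟩))
  ne (var y ts) [ x := u ] with eqv x y
  ... | same      = u ◇ (ts ⟨ x := u ⟩)
  ... | diff x y' = ne (var y' (ts ⟨ x := u ⟩))

  [] ⟨ x := u ⟩       = []
  (t ∷ ts) ⟨ x := u ⟩ = (t [ x := u ]) ∷ (ts ⟨ x := u ⟩)

  t ◇ []       = t
  t ◇ (u ∷ us) = napp t u ◇ us

  napp (lam t) u = t [ vz := u ]

  Sub : Con B → Con B → Set
  Sub Γ Δ = ∀ {σ} → Var Γ σ → Nf S Δ σ

  lift : ∀ {Γ Δ σ} → Sub Γ Δ → Sub (Γ ,, σ) (Δ ,, σ)
  lift θ vz     = nvar vz
  lift θ (vs x) = wkNf vz (θ x)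

  subNf : ∀ {Γ Δ τ} → Nf S Γ τ → Sub Γ Δ → Nf S Δ τ
  subSp : ∀ {Γ Δ τ ρ} → Sp S Γ τ ρ → Sub Γ Δ → Sp S Δ τ ρ
  subNf (lam t)        θ = lam (subNf t (lift θ))
  subNf (ne (var x ts)) θ = θ x ◇ subSp ts θ
  subNf (ne (fun f ts)) θ = ne (fun f (subSp ts θ))
  subSp []       θ = []
  subSp (t ∷ ts) θ = subNf t θ ∷ subSp ts θ

-- One-hole contexts C[ ] (binders of C may capture variables of the hole)

module _ {B : Set} (S : Signature B) where

  data Cx (Γ : Con B) (σ : Ty B) : Con B → Ty B → Set
  data SpCx (Γ : Con B) (σ : Ty B) : Con B → Ty B → Ty B → Set

  data Cx Γ σ where
    hole : Cx Γ σ Γ σ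
    lam  : ∀ {Δ α β} → Cx Γ σ (Δ ,, α) β → Cx Γ σ Δ (α ⇒ β)
    var  : ∀ {Δ α b} → Var Δ α → SpCx Γ σ Δ α (ι b) → Cx Γ σ Δ (ι b)
    fun  : ∀ {Δ b} (f : Sym S) → SpCx Γ σ Δ (type S f) (ι b) → Cx Γ σ Δ (ι b)

  data SpCx Γ σ where
    here  : ∀ {Δ α β ρ} → Cx Γ σ Δ α → Sp S Δ β ρ → SpCx Γ σ Δ (α ⇒ β) ρ
    there : ∀ {Δ α β ρ} → Nf S Δ α → SpCx Γ σ Δ β ρ → SpCx Γ σ Δ (α ⇒ β) ρ

module _ {B : Set} {S : Signature B} where

  plug   : ∀ {Γ σ Δ τ} → Cx S Γ σ Δ τ → Nf S Γ σ → Nf S Δ τ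
  plugSp : ∀ {Γ σ Δ τ ρ} → SpCx S Γ σ Δ τ ρ → Nf S Γ σ → Sp S Δ τ ρ
  plug hole       s = s
  plug (lam C)    s = lam (plug C s)
  plug (var x C)  s = ne (var x (plugSp C s))
  plug (fun f C)  s = ne (fun f (plugSp C s))
  plugSp (here C ts)  s = plug C s ∷ ts
  plugSp (there t C)  s = t ∷ plugSp C s

module _ {B : Set} (S : Signature B) where

  TRel : Set₁
  TRel = ∀ {Γ τ} → Nf S Γ τ → Nf S Γ τ → Set

  WellFoundedT : TRel → Set
  WellFoundedT R = ∀ {Γ τ} → WellFounded (λ (t s : Nf S Γ τ) → R s t)

  TransitiveT : TRel → Set
  TransitiveT R = ∀ {Γ τ} {s t u : Nf S Γ τ} → R s t → R t u → R s u

  ClosedUnderSubst : TRel → Set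
  ClosedUnderSubst R = ∀ {Γ Δ τ} (θ : Sub Γ Δ) {s t : Nf S Γ τ} →
                       R s t → R (subNf s θ) (subNf t θ)

  ClosedUnderCtx : TRel → Set
  ClosedUnderCtx R = ∀ {Γ σ Δ τ} (C : Cx S Γ σ Δ τ) {s t : Nf S Γ σ} →
                     R s t → R (plug C s) (plug C t)

  ReductionOrder : TRel → Set
  ReductionOrder R = WellFoundedT R × TransitiveT R × ClosedUnderSubst R × ClosedUnderCtx R

  ReductionPair : TRel → TRel → Set
  ReductionPair G R =
    WellFoundedT R × ClosedUnderSubst R × ClosedUnderCtx G × ClosedUnderSubst G ×
    ((∀ {Γ τ} {s t u : Nf S Γ τ} → G s t → R t u → R s u) ⊎
     (∀ {Γ τ} {s t u : Nf S Γ τ} → R s t → G t u → R s u))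

  StrictPart : TRel → TRel
  StrictPart G s t = G s t × ¬ G t s

  WeakReductionOrder : TRel → Set
  WeakReductionOrder G = ReductionPair G (StrictPart G)

module _ {B : Set} where

  FilterVal : Ty B → Set
  FilterVal σ = (Σ (Fin (length (args σ))) λ i → lookup (args σ) i ≡ ι (target σ))
                ⊎ List (Fin (length (args σ)))

  filtTy : (σ : Ty B) → FilterVal σ → Ty B
  filtTy σ (inj₁ _)  = σ
  filtTy σ (inj₂ is) = build (target σ) (map (lookup (args σ)) is)

ArgFilter : {B : Set} → Signature B → Set
ArgFilter S = (f : Sym S) → FilterVal (type S f)

filtSig : {B : Set} (S : Signature B) → ArgFilter S → Signature B
filtSig S π = record { Sym = Sym S ; type = λ f → filtTy (type S f) (π f) }

module _ {B : Set} {S : Signature B} where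

  spTarget : ∀ {Γ σ b} → Sp S Γ σ (ι b) → target σ ≡ b
  spTarget []       = refl
  spTarget (_ ∷ ts) = spTarget ts

  spArg : ∀ {Γ σ b} → Sp S Γ σ (ι b) → (i : Fin (length (args σ))) →
          Nf S Γ (lookup (args σ) i)
  spArg (t ∷ ts) zero    = t
  spArg (t ∷ ts) (suc i) = spArg ts i

  select : ∀ {Γ σ b} → Sp S Γ σ (ι b) → (is : List (Fin (length (args σ)))) →
           Sp S Γ (build (target σ) (map (lookup (args σ)) is)) (ι b)
  select ts []       = subst (λ c → Sp S _ (ι c) (ι _)) (sym (spTarget ts)) []
  select ts (i ∷ is) = spArg ts i ∷ select ts is

module _ {B : Set} (S : Signature B) (π : ArgFilter S) where

  private
    S' = filtSig S π

  filtFun : ∀ {Γ b} (f : Sym S) (p : FilterVal (type S f)) →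
            Sp S' Γ (type S f) (ι b) →
            (Sp S' Γ (filtTy (type S f) p) (ι b) → Nf S' Γ (ι b)) →
            Nf S' Γ (ι b)
  filtFun f (inj₁ (i , eq)) ts k =
    subst (Nf S' _) (trans eq (Relation.Binary.PropositionalEquality.cong ι (spTarget ts))) (spArg ts i)
  filtFun f (inj₂ is) ts k = k (select ts is)

  πNf : ∀ {Γ τ} → Nf S Γ τ → Nf S' Γ τ
  πSp : ∀ {Γ τ ρ} → Sp S Γ τ ρ → Sp S' Γ τ ρ
  πNf (lam t)          = lam (πNf t)
  πNf (ne (var x ts))  = ne (var x (πSp ts))
  πNf (ne (fun f ts))  = filtFun f (π f) (πSp ts) (λ sp → ne (fun f sp))
  πSp []       = []
  πSp (t ∷ ts) = πNf t ∷ πSp ts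

  ≳π : TRel S' → TRel S
  ≳π _>_ s t = (πNf s > πNf t) ⊎ (πNf s ≡ πNf t)

-- Filtering commutes with hereditary substitution: π(sθ↓) is π(s) under the
-- substitution π ∘ θ, so ≳_π inherits closure under substitution from > and
-- from ≡. For contexts, induct on C: below a function symbol π keeps, drops
-- or projects to arguments, and each of these preserves the argument-wise
-- reflexive closure of >, which is context-closed because > is. As > is
-- well-founded, hence asymmetric, the strict part of ≳_π is exactly
-- π(s) > π(t), and the remaining properties transfer from >.
module Submission where

open import Defs
open import Data.List using ([]; _∷_)
open import Data.Fin using (zero; suc)
open import Data.Product using (_,_)
open import Data.Sum using (_⊎_; inj₁; inj₂)
open import Data.Empty using (⊥; ⊥-elim)
open import Function using (_∘_)
open import Relation.Binary.PropositionalEquality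
open import Induction.WellFounded using (wf⇒asym; module Subrelation)
import Relation.Binary.Construct.On as On

filterFun : {B : Set} (S : Signature B) (π : ArgFilter S) {Γ : Con B} {b : B} (f : Sym S) →
            Sp (filtSig S π) Γ (type S f) (ι b) → Nf (filtSig S π) Γ (ι b)
filterFun S π f ts = filtFun S π f (π f) ts (λ sp → ne (fun f sp))

module SpineMap {B : Set} (S : Signature B) (π : ArgFilter S) {Γ₁ Γ₂ : Con B}
  (mapNf : ∀ {τ} → Nf (filtSig S π) Γ₁ τ → Nf (filtSig S π) Γ₂ τ)
  (mapSp : ∀ {τ ρ} → Sp (filtSig S π) Γ₁ τ ρ → Sp (filtSig S π) Γ₂ τ ρ)
  (map-[] : ∀ {σ} → mapSp {σ} {σ} [] ≡ [])
  (map-∷ : ∀ {σ τ ρ} (t : Nf (filtSig S π) Γ₁ σ) (ts : Sp (filtSig S π) Γ₁ τ ρ) →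
           mapSp (t ∷ ts) ≡ mapNf t ∷ mapSp ts)
  (map-fun : ∀ {b} (f : Sym S) (ts : Sp (filtSig S π) Γ₁ (filtTy (type S f) (π f)) (ι b)) →
             mapNf (ne (fun f ts)) ≡ ne (fun f (mapSp ts)))
  where

  private
    S' = filtSig S π

  spTarget-map : ∀ {σ b} (ts : Sp S' Γ₁ σ (ι b)) → spTarget (mapSp ts) ≡ spTarget ts
  spTarget-map {b = b} [] rewrite map-[] {ι b} = refl
  spTarget-map (t ∷ ts) rewrite map-∷ t ts     = spTarget-map ts

  spArg-map : ∀ {σ b} (ts : Sp S' Γ₁ σ (ι b)) i → spArg (mapSp ts) i ≡ mapNf (spArg ts i)
  spArg-map (t ∷ ts) zero    rewrite map-∷ t ts = refl
  spArg-map (t ∷ ts) (suc i) rewrite map-∷ t ts = spArg-map ts i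

  subst-map : ∀ {α α'} (e : α ≡ α') (t : Nf S' Γ₁ α) →
              mapNf (subst (Nf S' Γ₁) e t) ≡ subst (Nf S' Γ₂) e (mapNf t)
  subst-map refl t = refl

  subst-[]-map : ∀ {b c} (e : b ≡ c) →
                 mapSp (subst (λ d → Sp S' Γ₁ (ι d) (ι b)) e []) ≡ subst (λ d → Sp S' Γ₂ (ι d) (ι b)) e []
  subst-[]-map refl = map-[]

  select-map : ∀ {σ b} (ts : Sp S' Γ₁ σ (ι b)) is → mapSp (select ts is) ≡ select (mapSp ts) is
  select-map ts []       rewrite spTarget-map ts = subst-[]-map (sym (spTarget ts))
  select-map ts (i ∷ is) = trans (map-∷ _ _) (cong₂ _∷_ (sym (spArg-map ts i)) (select-map ts is))

  filtFun-map : ∀ {b} f p (ts : Sp S' Γ₁ (type S f) (ι b))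
                (k : Sp S' Γ₁ (filtTy (type S f) p) (ι b) → Nf S' Γ₁ (ι b))
                (k' : Sp S' Γ₂ (filtTy (type S f) p) (ι b) → Nf S' Γ₂ (ι b)) →
                (∀ sp → mapNf (k sp) ≡ k' (mapSp sp)) →
                mapNf (filtFun S π f p ts k) ≡ filtFun S π f p (mapSp ts) k'
  filtFun-map f (inj₁ (i , eq)) ts k k' k-map rewrite spTarget-map ts | spArg-map ts i = subst-map _ _
  filtFun-map f (inj₂ is)       ts k k' k-map = trans (k-map (select ts is)) (cong k' (select-map ts is))

  filterFun-map : ∀ {b} f (ts : Sp S' Γ₁ (type S f) (ι b)) →
                  mapNf (filterFun S π f ts) ≡ filterFun S π f (mapSp ts)
  filterFun-map f ts = filtFun-map f (π f) ts _ _ (map-fun f)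

module FilterCommutes {B : Set} (S : Signature B) (π : ArgFilter S) where

  private
    S' = filtSig S π
    πN : ∀ {Γ τ} → Nf S Γ τ → Nf S' Γ τ
    πN = πNf S π
    πS : ∀ {Γ τ ρ} → Sp S Γ τ ρ → Sp S' Γ τ ρ
    πS = πSp S π
    module Wk {Γ : Con B} {σ : Ty B} (x : Var Γ σ) =
      SpineMap S π (wkNf {S = S'} x) (wkSp x) refl (λ _ _ → refl) (λ _ _ → refl)
    module HSub {Γ : Con B} {σ : Ty B} (x : Var Γ σ) (u : Nf S' (Γ - x) σ) =
      SpineMap S π (_[ x := u ]) (_⟨ x := u ⟩) refl (λ _ _ → refl) (λ _ _ → refl)
    module PSub {Γ Δ : Con B} (θ : Sub Γ Δ) =
      SpineMap S π (λ t → subNf t θ) (λ ts → subSp ts θ) refl (λ _ _ → refl) (λ _ _ → refl)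

  π-wkNf : ∀ {Γ σ τ} (x : Var Γ σ) (t : Nf S (Γ - x) τ) → πN (wkNf x t) ≡ wkNf x (πN t)
  π-wkSp : ∀ {Γ σ τ ρ} (x : Var Γ σ) (ts : Sp S (Γ - x) τ ρ) → πS (wkSp x ts) ≡ wkSp x (πS ts)
  π-wkNf x (lam t)         = cong lam (π-wkNf (vs x) t)
  π-wkNf x (ne (var y ts)) = cong (ne ∘ var (wkv x y)) (π-wkSp x ts)
  π-wkNf x (ne (fun f ts)) =
    trans (cong (filterFun S π f) (π-wkSp x ts)) (sym (Wk.filterFun-map x f (πS ts)))
  π-wkSp x []       = refl
  π-wkSp x (t ∷ ts) = cong₂ _∷_ (π-wkNf x t) (π-wkSp x ts)

  π-appSp : ∀ {Γ ρ σ τ} (ts : Sp S Γ ρ (σ ⇒ τ)) (u : Nf S Γ σ) →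
            πS (appSp ts u) ≡ appSp (πS ts) (πN u)
  π-appSp []       u = refl
  π-appSp (t ∷ ts) u = cong (πN t ∷_) (π-appSp ts u)

  π-ne2nf : ∀ {Γ σ ρ} (x : Var Γ ρ) (ts : Sp S Γ ρ σ) → πN (ne2nf x ts) ≡ ne2nf x (πS ts)
  π-ne2nf {σ = ι b}   x ts = refl
  π-ne2nf {σ = σ ⇒ τ} x ts = cong lam (begin
      πN (ne2nf (vs x) (appSp (wkSp vz ts) (nvar vz)))
    ≡⟨ π-ne2nf (vs x) (appSp (wkSp vz ts) (nvar vz)) ⟩
      ne2nf (vs x) (πS (appSp (wkSp vz ts) (nvar vz)))
    ≡⟨ cong (ne2nf (vs x)) (π-appSp (wkSp vz ts) (nvar vz)) ⟩
      ne2nf (vs x) (appSp (πS (wkSp vz ts)) (πN (nvar vz)))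
    ≡⟨ cong (ne2nf (vs x)) (cong₂ appSp (π-wkSp vz ts) (π-ne2nf vz [])) ⟩
      ne2nf (vs x) (appSp (wkSp vz (πS ts)) (nvar vz))
    ∎)
    where open ≡-Reasoning

  π-[:=] : ∀ {Γ σ τ} (t : Nf S Γ τ) (x : Var Γ σ) (u : Nf S (Γ - x) σ) →
           πN (t [ x := u ]) ≡ πN t [ x := πN u ]
  π-⟨:=⟩ : ∀ {Γ σ τ ρ} (ts : Sp S Γ τ ρ) (x : Var Γ σ) (u : Nf S (Γ - x) σ) →
           πS (ts ⟨ x := u ⟩) ≡ πS ts ⟨ x := πN u ⟩
  π-◇    : ∀ {Γ σ τ} (t : Nf S Γ σ) (ts : Sp S Γ σ τ) → πN (t ◇ ts) ≡ πN t ◇ πS ts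
  π-napp : ∀ {Γ σ τ} (t : Nf S Γ (σ ⇒ τ)) (u : Nf S Γ σ) → πN (napp t u) ≡ napp (πN t) (πN u)
  π-[:=] (lam t) x u =
    cong lam (trans (π-[:=] t (vs x) (wkNf vz u)) (cong (πN t [ vs x :=_]) (π-wkNf vz u)))
  π-[:=] (ne (fun f ts)) x u =
    trans (cong (filterFun S π f) (π-⟨:=⟩ ts x u)) (sym (HSub.filterFun-map x (πN u) f (πS ts)))
  π-[:=] (ne (var y ts)) x u with eqv x y
  ... | same      = trans (π-◇ u (ts ⟨ x := u ⟩)) (cong (πN u ◇_) (π-⟨:=⟩ ts x u))
  ... | diff _ y' = cong (ne ∘ var y') (π-⟨:=⟩ ts x u)
  π-⟨:=⟩ []       x u = refl
  π-⟨:=⟩ (t ∷ ts) x u = cong₂ _∷_ (π-[:=] t x u) (π-⟨:=⟩ ts x u)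
  π-◇ t []       = refl
  π-◇ t (u ∷ us) = trans (π-◇ (napp t u) us) (cong (_◇ πS us) (π-napp t u))
  π-napp (lam t) u = π-[:=] t vz u

  -- θ' is taken extensionally equal to π ∘ θ because lift (π ∘ θ) and
  -- π ∘ lift θ agree only propositionally.
  π-subNf : ∀ {Γ Δ τ} (t : Nf S Γ τ) (θ : Sub Γ Δ) (θ' : Sub Γ Δ) →
            (∀ {σ} (x : Var Γ σ) → θ' x ≡ πN (θ x)) → πN (subNf t θ) ≡ subNf (πN t) θ'
  π-subSp : ∀ {Γ Δ τ ρ} (ts : Sp S Γ τ ρ) (θ : Sub Γ Δ) (θ' : Sub Γ Δ) →
            (∀ {σ} (x : Var Γ σ) → θ' x ≡ πN (θ x)) → πS (subSp ts θ) ≡ subSp (πS ts) θ'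
  π-subNf (lam t) θ θ' θ'≡ = cong lam (π-subNf t (lift θ) (lift θ') lift-θ'≡)
    where
    lift-θ'≡ : ∀ {σ} (x : Var _ σ) → lift θ' x ≡ πN (lift θ x)
    lift-θ'≡ vz     = sym (π-ne2nf vz [])
    lift-θ'≡ (vs x) = trans (cong (wkNf vz) (θ'≡ x)) (sym (π-wkNf vz (θ x)))
  π-subNf (ne (var x ts)) θ θ' θ'≡ =
    trans (π-◇ (θ x) (subSp ts θ)) (cong₂ _◇_ (sym (θ'≡ x)) (π-subSp ts θ θ' θ'≡))
  π-subNf (ne (fun f ts)) θ θ' θ'≡ =
    trans (cong (filterFun S π f) (π-subSp ts θ θ' θ'≡)) (sym (PSub.filterFun-map θ' f (πS ts)))
  π-subSp []       θ θ' θ'≡ = refl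
  π-subSp (t ∷ ts) θ θ' θ'≡ = cong₂ _∷_ (π-subNf t θ θ' θ'≡) (π-subSp ts θ θ' θ'≡)

  closedUnderSubst-on-π : (R : TRel S') → ClosedUnderSubst S' R →
                          ClosedUnderSubst S (λ s t → R (πN s) (πN t))
  closedUnderSubst-on-π R R-subst θ {s} {t} sRt =
    subst₂ R (sym (π-subNf s θ θ' (λ _ → refl))) (sym (π-subNf t θ θ' (λ _ → refl)))
             (R-subst θ' sRt)
    where
    θ' : Sub _ _
    θ' = πN ∘ θ

module ReflexiveClosure {B : Set} {T : Signature B} (_>_ : TRel T) where

  infix 4 _≥_ _≥*_

  _≥_ : TRel T
  s ≥ t = (s > t) ⊎ (s ≡ t)

  data _≥*_ {Γ : Con B} : ∀ {σ ρ} → Sp T Γ σ ρ → Sp T Γ σ ρ → Set where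
    []  : ∀ {σ} → [] ≥* [] {σ = σ}
    _∷_ : ∀ {σ τ ρ} {t u : Nf T Γ σ} {ts us : Sp T Γ τ ρ} → t ≥ u → ts ≥* us → (t ∷ ts) ≥* (u ∷ us)

  ≥-refl : ∀ {Γ τ} {s : Nf T Γ τ} → s ≥ s
  ≥-refl = inj₂ refl

  ≥*-refl : ∀ {Γ σ ρ} (ts : Sp T Γ σ ρ) → ts ≥* ts
  ≥*-refl []       = []
  ≥*-refl (t ∷ ts) = ≥-refl ∷ ≥*-refl ts

  ≥-subst : ∀ {Γ α α'} (e : α ≡ α') {s t : Nf T Γ α} → s ≥ t → subst (Nf T Γ) e s ≥ subst (Nf T Γ) e t
  ≥-subst refl s≥t = s≥t

  ≥-closedUnderSubst : ClosedUnderSubst T _>_ → ClosedUnderSubst T _≥_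
  ≥-closedUnderSubst >-subst θ (inj₁ s>t) = inj₁ (>-subst θ s>t)
  ≥-closedUnderSubst >-subst θ (inj₂ s≡t) = inj₂ (cong (λ r → subNf r θ) s≡t)

  ≥-closedUnderCtx : ClosedUnderCtx T _>_ → ClosedUnderCtx T _≥_
  ≥-closedUnderCtx >-ctx C (inj₁ s>t) = inj₁ (>-ctx C s>t)
  ≥-closedUnderCtx >-ctx C (inj₂ s≡t) = inj₂ (cong (plug C) s≡t)

  ≥-trans : TransitiveT T _>_ → TransitiveT T _≥_
  ≥-trans >-trans (inj₁ s>t) (inj₁ t>u) = inj₁ (>-trans s>t t>u)
  ≥-trans >-trans (inj₁ s>t) (inj₂ refl) = inj₁ s>t
  ≥-trans >-trans (inj₂ refl) t≥u       = t≥u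

  ≥-trans-> : TransitiveT T _>_ → ∀ {Γ τ} {s t u : Nf T Γ τ} → s ≥ t → t > u → s > u
  ≥-trans-> >-trans (inj₁ s>t) t>u = >-trans s>t t>u
  ≥-trans-> >-trans (inj₂ refl) t>u = t>u

  spTarget-≥* : ∀ {Γ σ b} {ts us : Sp T Γ σ (ι b)} → ts ≥* us → spTarget ts ≡ spTarget us
  spTarget-≥* []          = refl
  spTarget-≥* (_ ∷ ts≥us) = spTarget-≥* ts≥us

  spArg-≥* : ∀ {Γ σ b} {ts us : Sp T Γ σ (ι b)} → ts ≥* us → ∀ i → spArg ts i ≥ spArg us i
  spArg-≥* (t≥u ∷ _)   zero    = t≥u
  spArg-≥* (_ ∷ ts≥us) (suc i) = spArg-≥* ts≥us i

  select-≥* : ∀ {Γ σ b} {ts us : Sp T Γ σ (ι b)} → ts ≥* us → ∀ is → select ts is ≥* select us is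
  select-≥* ts≥us []       rewrite spTarget-≥* ts≥us = ≥*-refl _
  select-≥* ts≥us (i ∷ is) = spArg-≥* ts≥us i ∷ select-≥* ts≥us is

  -- Compare the arguments one at a time, absorbing each compared argument
  -- into w; the hypothesis realises a change of one argument as a context.
  ≥-spine : TransitiveT T _>_ → ClosedUnderCtx T _>_ →
            ∀ {Γ σ ρ τ} (w : Sp T Γ σ ρ → Nf T Γ τ) (cx : ∀ {α} → SpCx T Γ α Γ σ ρ → Cx T Γ α Γ τ) →
            (∀ {α} (D : SpCx T Γ α Γ σ ρ) t → plug (cx D) t ≡ w (plugSp D t)) →
            ∀ {ts us} → ts ≥* us → w ts ≥ w us
  ≥-spine >-trans >-ctx w cx plug-cx [] = ≥-refl
  ≥-spine >-trans >-ctx w cx plug-cx (_∷_ {t = t} {u} {ts} t≥u ts≥us) =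
    ≥-trans >-trans
      (subst₂ _≥_ (plug-cx (here hole ts) t) (plug-cx (here hole ts) u)
                  (≥-closedUnderCtx >-ctx (cx (here hole ts)) t≥u))
      (≥-spine >-trans >-ctx (w ∘ (u ∷_)) (cx ∘ there u) (λ D → plug-cx (there u D)) ts≥us)

module FilteredOrder {B : Set} (S : Signature B) (π : ArgFilter S) (_>_ : TRel (filtSig S π))
  (>-trans : TransitiveT (filtSig S π) _>_) (>-ctx : ClosedUnderCtx (filtSig S π) _>_) where

  private
    S' = filtSig S π
    πN : ∀ {Γ τ} → Nf S Γ τ → Nf S' Γ τ
    πN = πNf S π
    πS : ∀ {Γ τ ρ} → Sp S Γ τ ρ → Sp S' Γ τ ρ
    πS = πSp S π

  open ReflexiveClosure _>_

  ≥-filtFun : ∀ {Γ b} f p {ts us : Sp S' Γ (type S f) (ι b)}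
              (k : Sp S' Γ (filtTy (type S f) p) (ι b) → Nf S' Γ (ι b)) →
              (∀ {sp sp'} → sp ≥* sp' → k sp ≥ k sp') → ts ≥* us →
              filtFun S π f p ts k ≥ filtFun S π f p us k
  ≥-filtFun f (inj₁ (i , eq)) k k-mono ts≥us rewrite spTarget-≥* ts≥us = ≥-subst _ (spArg-≥* ts≥us i)
  ≥-filtFun f (inj₂ is)       k k-mono ts≥us = k-mono (select-≥* ts≥us is)

  ≥-plug : ∀ {Γ σ Δ τ} (C : Cx S Γ σ Δ τ) {s t : Nf S Γ σ} →
           πN s ≥ πN t → πN (plug C s) ≥ πN (plug C t)
  ≥*-plugSp : ∀ {Γ σ Δ τ ρ} (D : SpCx S Γ σ Δ τ ρ) {s t : Nf S Γ σ} →
              πN s ≥ πN t → πS (plugSp D s) ≥* πS (plugSp D t)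
  ≥-plug hole      s≥t = s≥t
  ≥-plug (lam C)   s≥t = ≥-closedUnderCtx >-ctx (lam hole) (≥-plug C s≥t)
  ≥-plug (var x D) s≥t = ≥-spine >-trans >-ctx (ne ∘ var x) (var x) (λ _ _ → refl) (≥*-plugSp D s≥t)
  ≥-plug (fun f D) s≥t =
    ≥-filtFun f (π f) (ne ∘ fun f) (≥-spine >-trans >-ctx (ne ∘ fun f) (fun f) (λ _ _ → refl))
              (≥*-plugSp D s≥t)
  ≥*-plugSp (here C ts) s≥t = ≥-plug C s≥t ∷ ≥*-refl _
  ≥*-plugSp (there t D) s≥t = ≥-refl ∷ ≥*-plugSp D s≥t

  ≳π-closedUnderCtx : ClosedUnderCtx S (≳π S π _>_)
  ≳π-closedUnderCtx C {s} {t} = ≥-plug C {s} {t}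

module FilteredStrictPart {B : Set} (S : Signature B) (π : ArgFilter S) (_>_ : TRel (filtSig S π))
  (>-asym : ∀ {Γ τ} {s t : Nf (filtSig S π) Γ τ} → s > t → t > s → ⊥) where

  private
    _≻_ : TRel S
    _≻_ = StrictPart S (≳π S π _>_)

  ≻⇒> : ∀ {Γ τ} {s t : Nf S Γ τ} → s ≻ t → πNf S π s > πNf S π t
  ≻⇒> (inj₁ s>t , _)   = s>t
  ≻⇒> (inj₂ s≡t , t≱s) = ⊥-elim (t≱s (inj₂ (sym s≡t)))

  >⇒≻ : ∀ {Γ τ} {s t : Nf S Γ τ} → πNf S π s > πNf S π t → s ≻ t
  >⇒≻ s>t = inj₁ s>t , λ { (inj₁ t>s) → >-asym s>t t>s
                         ; (inj₂ t≡s) → >-asym s>t (subst₂ _>_ (sym t≡s) t≡s s>t) }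

  ≻-wellFounded : WellFoundedT (filtSig S π) _>_ → WellFoundedT S _≻_
  ≻-wellFounded >-wf = Subrelation.wellFounded (λ {t} {s} → ≻⇒> {s = s} {t}) (On.wellFounded (πNf S π) >-wf)

  ≻-closedUnderSubst : ClosedUnderSubst (filtSig S π) _>_ → ClosedUnderSubst S _≻_
  ≻-closedUnderSubst >-subst θ {s} {t} =
    >⇒≻ {s = subNf s θ} {subNf t θ} ∘ closedUnderSubst-on-π _>_ >-subst θ {s} {t} ∘ ≻⇒> {s = s} {t}
    where open FilterCommutes S π

  ≳π-trans-≻ : TransitiveT (filtSig S π) _>_ →
               ∀ {Γ τ} {s t u : Nf S Γ τ} → ≳π S π _>_ s t → t ≻ u → s ≻ u
  ≳π-trans-≻ >-trans {s = s} {t} {u} s≳t t≻u =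
    >⇒≻ {s = s} {u} (≥-trans-> >-trans s≳t (≻⇒> {s = t} {u} t≻u))
    where open ReflexiveClosure _>_

theorem2 : {B : Set} (S : Signature B) (π : ArgFilter S) (_>_ : TRel (filtSig S π)) →
           ReductionOrder (filtSig S π) _>_ →
           WeakReductionOrder S (≳π S π _>_)
theorem2 S π _>_ (>-wf , >-trans , >-subst , >-ctx) =
    ≻-wellFounded >-wf
  , ≻-closedUnderSubst >-subst
  , ≳π-closedUnderCtx
  , closedUnderSubst-on-π _≥_ (≥-closedUnderSubst >-subst)
  , inj₁ (λ {_} {_} {s} {t} {u} → ≳π-trans-≻ >-trans {s = s} {t} {u})
  where
  open FilterCommutes S π
  open ReflexiveClosure _>_
  open FilteredOrder S π _>_ >-trans >-ctx
  open FilteredStrictPart S π _>_ (wf⇒asym >-wf)
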